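{- For every digraph $D$ of order $n$, $\gamma_{iso}(D)\le n-\delta^-(D)$, and the bound is sharp.
   Context: Digraphs $D=(V,A)$ are finite, without loops or multiple arcs (pairs of opposite arcs allowed). $N^+(v)=\{w: vw\in A\}$, $N^-(v)=\{w: wv\in A\}$, $\delta^-(D)=\min_v |N^-(v)|$. $S\subseteq V$ is out-dominating if every $v\in V\setminus S$ has an in-neighbor in $S$. $S$ is an in-secure out-dominating set (ISODS) if $S$ is out-dominating and for every $v\in V\setminus S$ there is $u\in N^+(v)\cap S$ such that $(S\setminus\{u\})\cup\{v\}$ is out-dominating; $\gamma_{iso}(D)$ is the minimum size of an ISODS. Sharp means equality holds for some digraph (e.g. the directed $4$-cycle). -}

module Defs where

open import Data.Nat using (ℕ; _⊓_)
open import Data.Bool using (Bool; true; false)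
open import Data.Fin using (Fin)
open import Data.Fin.Subset using (Subset; _∈_; _∉_; _∪_; _-_; ⁅_⁆; ∣_∣)
open import Data.Vec using (tabulate)
open import Data.List using (foldr; map; allFin)
open import Data.Product using (Σ; _×_)
open import Relation.Binary.PropositionalEquality using (_≡_)

-- Multiple arcs are impossible by construction; opposite arcs are allowed.
record Digraph (n : ℕ) : Set where
  field
    adj      : Fin n → Fin n → Bool
    loopless : ∀ v → adj v v ≡ false
open Digraph public

inNbhd : ∀ {n} → Digraph n → Fin n → Subset n
inNbhd D v = tabulate (λ u → adj D u v)

indeg : ∀ {n} → Digraph n → Fin n → ℕ
indeg D v = ∣ inNbhd D v ∣

-- δ^-(D) = min_v |N^-(v)|.  (Start value n is ≥ every in-degree, so for
-- n ≥ 1 this is exactly the minimum; for n = 0 it is 0.)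
minIndeg : ∀ {n} → Digraph n → ℕ
minIndeg {n} D = foldr _⊓_ n (map (indeg D) (allFin n))

OutDominating : ∀ {n} → Digraph n → Subset n → Set
OutDominating {n} D S =
  ∀ (v : Fin n) → v ∉ S → Σ (Fin n) (λ u → u ∈ S × adj D u v ≡ true)

ISODS : ∀ {n} → Digraph n → Subset n → Set
ISODS {n} D S =
  OutDominating D S ×
  (∀ (v : Fin n) → v ∉ S →
     Σ (Fin n) (λ u → adj D v u ≡ true × u ∈ S ×
        OutDominating D ((S - u) ∪ ⁅ v ⁆)))

IsoDomNumber : ∀ {n} → Digraph n → ℕ → Set
IsoDomNumber {n} D k =
  Σ (Subset n) (λ S → ISODS D S × ∣ S ∣ ≡ k) ×
  (∀ (S : Subset n) → ISODS D S → k Data.Nat.≤ ∣ S ∣)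

-- Let w be a vertex of minimum in-degree and S = V ∖ N⁻(w), so |S| = n − δ⁻(D).
-- If some x ∈ N⁻(w) had no in-neighbour in S, then N⁻(x) ⊆ N⁻(w) ∖ {x}, so x
-- would have smaller in-degree than w.  Every v ∉ S is an in-neighbour of w
-- and can be swapped with w ∈ S: a vertex x ≠ w left undominated by
-- (S ∖ {w}) ∪ {v} would satisfy N⁻(x) ∖ {w} ⊆ N⁻(w) ∖ {v, x}, again giving
-- indeg x < indeg w.  Sharpness: on the directed 2-cycle, n − δ⁻ = 1, and an
-- out-dominating set of a nonempty digraph is nonempty.
module Submission where

open import Defs
open import Data.Nat using (ℕ; suc; _≤_; _<_; _∸_; s≤s; z≤n)
open import Data.Nat.Properties
  using (≤-refl; ≤-trans; ≤-antisym; m≤n⇒m≤1+n; ≤-reflexive; <⇒≱; m+n∸n≡m; m⊓n≤m; m⊓n≤n;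
         ∸-monoʳ-≤; module ≤-Reasoning)
open import Data.Bool using (Bool; true; false)
open import Data.Bool.Properties using () renaming (_≟_ to _≟ᵇ_)
open import Data.Fin using (Fin; zero; suc; _≟_)
open import Data.Fin.Properties using (any?)
open import Data.Fin.Subset
  using (Subset; inside; outside; ∁; _∈_; _∉_; _⊆_; _⊈_; _⊂_; _∪_; _-_; ⁅_⁆; ∣_∣)
open import Data.Fin.Subset.Properties
  using (_∈?_; x∈∁p⇒x∉p; x∉∁p⇒x∈p; x∉p⇒x∈∁p; ∣∁p∣≡n∸∣p∣; p─⊥≡p; p⊂q⇒∣p∣<∣q∣;
         x∈p⇒∣p-x∣<∣p∣; p─q⊆p; x∈p∧x≢y⇒x∈p-y; x∈⁅x⁆; x∈p∪q⁺)
open import Data.Vec using ([]; _∷_; there)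
open import Data.Vec.Properties using ([]=⇒lookup; lookup∘tabulate)
open import Data.List using (foldr; map; allFin)
open import Data.List.Properties using (foldr-forcesᵇ)
import Data.List.Relation.Unary.All as All
import Data.List.Relation.Unary.Any as Any
open import Data.List.Membership.Propositional.Properties using (∈-allFin; ∈-map⁺)
open import Data.List.Extrema.Nat using (argmin; f[argmin]≤v⁺)
open import Data.Product using (Σ; _×_; _,_)
open import Data.Sum using (inj₁; inj₂)
open import Relation.Nullary using (yes; no)
open import Data.Empty using (⊥-elim)
open import Relation.Nullary.Decidable using (_×-dec_)
open import Relation.Binary.PropositionalEquality using (_≡_; _≢_; refl; sym; trans; cong)
open import Function using (_∘_)

∣p∣≤1+∣p-x∣ : ∀ {n} (p : Subset n) x → ∣ p ∣ ≤ suc ∣ p - x ∣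
∣p∣≤1+∣p-x∣ (inside  ∷ p) zero    = s≤s (≤-reflexive (cong ∣_∣ (sym (p─⊥≡p p))))
∣p∣≤1+∣p-x∣ (outside ∷ p) zero    = m≤n⇒m≤1+n (≤-reflexive (cong ∣_∣ (sym (p─⊥≡p p))))
∣p∣≤1+∣p-x∣ (inside  ∷ p) (suc x) = s≤s (∣p∣≤1+∣p-x∣ p x)
∣p∣≤1+∣p-x∣ (outside ∷ p) (suc x) = ∣p∣≤1+∣p-x∣ p x

p-y⊂q-z⇒∣p∣<∣q∣ : ∀ {n} {p q : Subset n} {y z} → z ∈ q → p - y ⊂ q - z → ∣ p ∣ < ∣ q ∣
p-y⊂q-z⇒∣p∣<∣q∣ {p = p} {q} {y} {z} z∈q p-y⊂q-z = begin-strict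
  ∣ p ∣          ≤⟨ ∣p∣≤1+∣p-x∣ p y ⟩
  suc ∣ p - y ∣  <⟨ s≤s (p⊂q⇒∣p∣<∣q∣ p-y⊂q-z) ⟩
  suc ∣ q - z ∣  ≤⟨ x∈p⇒∣p-x∣<∣p∣ z∈q ⟩
  ∣ q ∣          ∎
  where open ≤-Reasoning

x∉p-x : ∀ {n} (p : Subset n) x → x ∉ p - x
x∉p-x (_ ∷ p) zero    ()
x∉p-x (_ ∷ p) (suc x) (there x∈p-x) = x∉p-x p x x∈p-x

x∈p-y⇒x≢y : ∀ {n} {p : Subset n} {x y} → x ∈ p - y → x ≢ y
x∈p-y⇒x≢y {p = p} {x} x∈p-x refl = x∉p-x p x x∈p-x

module _ {n} (D : Digraph n) where

  ∈-inNbhd⁻ : ∀ {u v} → u ∈ inNbhd D v → adj D u v ≡ true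
  ∈-inNbhd⁻ {u} {v} u∈N = trans (sym (lookup∘tabulate _ u)) ([]=⇒lookup u∈N)

  ∉-inNbhd-self : ∀ v → v ∉ inNbhd D v
  ∉-inNbhd-self v v∈N with trans (sym (∈-inNbhd⁻ v∈N)) (loopless D v)
  ... | ()

  inNbhd⊈∁⇒outDominating : ∀ {S} → (∀ v → v ∉ S → inNbhd D v ⊈ ∁ S) → OutDominating D S
  inNbhd⊈∁⇒outDominating {S} undominated⇒⊥ v v∉S
    with any? (λ u → (u ∈? S) ×-dec (adj D u v ≟ᵇ true))
  ... | yes dominator = dominator
  ... | no ¬dominator = ⊥-elim (undominated⇒⊥ v v∉S inNbhd⊆∁S)
    where
    inNbhd⊆∁S : inNbhd D v ⊆ ∁ S
    inNbhd⊆∁S {u} u∈N = x∉p⇒x∈∁p (λ u∈S → ¬dominator (u , u∈S , ∈-inNbhd⁻ u∈N))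

module MinimumInDegree {n} (D : Digraph n) (w : Fin n)
                       (w-minimal : ∀ x → indeg D w ≤ indeg D x) where

  S : Subset n
  S = ∁ (inNbhd D w)

  ∣S∣≡n∸indeg : ∣ S ∣ ≡ n ∸ indeg D w
  ∣S∣≡n∸indeg = ∣∁p∣≡n∸∣p∣ (inNbhd D w)

  w∈S : w ∈ S
  w∈S = x∉p⇒x∈∁p (∉-inNbhd-self D w)

  ∉S⇒∈inNbhd : ∀ {x} → x ∉ S → x ∈ inNbhd D w
  ∉S⇒∈inNbhd = x∉∁p⇒x∈p

  S-outDominating : OutDominating D S
  S-outDominating = inNbhd⊈∁⇒outDominating D undominated⇒⊥
    where
    undominated⇒⊥ : ∀ x → x ∉ S → inNbhd D x ⊈ ∁ S
    undominated⇒⊥ x x∉S N⁻x⊆∁S = <⇒≱ (p⊂q⇒∣p∣<∣q∣ N⁻x⊂N⁻w) (w-minimal x)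
      where
      N⁻x⊂N⁻w : inNbhd D x ⊂ inNbhd D w
      N⁻x⊂N⁻w = (λ u∈N⁻x → ∉S⇒∈inNbhd (x∈∁p⇒x∉p (N⁻x⊆∁S u∈N⁻x)))
              , x , ∉S⇒∈inNbhd x∉S , ∉-inNbhd-self D x

  module Swap {v} (v∉S : v ∉ S) where

    S′ : Subset n
    S′ = (S - w) ∪ ⁅ v ⁆

    v∈S′ : v ∈ S′
    v∈S′ = x∈p∪q⁺ (inj₂ (x∈⁅x⁆ v))

    ∉S′⇒∈inNbhd-v : ∀ {u} → u ∉ S′ → u ≢ w → u ∈ inNbhd D w - v
    ∉S′⇒∈inNbhd-v u∉S′ u≢w = x∈p∧x≢y⇒x∈p-y
      (∉S⇒∈inNbhd (λ u∈S → u∉S′ (x∈p∪q⁺ (inj₁ (x∈p∧x≢y⇒x∈p-y u∈S u≢w)))))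
      (λ { refl → u∉S′ v∈S′ })

    S′-outDominating : OutDominating D S′
    S′-outDominating = inNbhd⊈∁⇒outDominating D undominated⇒⊥
      where
      undominated⇒⊥ : ∀ x → x ∉ S′ → inNbhd D x ⊈ ∁ S′
      undominated⇒⊥ x x∉S′ N⁻x⊆∁S′ with x ≟ w
      ... | yes refl = x∈∁p⇒x∉p (N⁻x⊆∁S′ (∉S⇒∈inNbhd v∉S)) v∈S′
      ... | no x≢w = <⇒≱ (p-y⊂q-z⇒∣p∣<∣q∣ (∉S⇒∈inNbhd v∉S) N⁻x-w⊂N⁻w-v) (w-minimal x)
        where
        N⁻x-w⊂N⁻w-v : inNbhd D x - w ⊂ inNbhd D w - v
        N⁻x-w⊂N⁻w-v =
          (λ u∈N⁻x-w → ∉S′⇒∈inNbhd-v (x∈∁p⇒x∉p (N⁻x⊆∁S′ (p─q⊆p _ _ u∈N⁻x-w)))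
                                       (x∈p-y⇒x≢y u∈N⁻x-w))
          , x , ∉S′⇒∈inNbhd-v x∉S′ x≢w , ∉-inNbhd-self D x ∘ p─q⊆p _ _

  S-isods : ISODS D S
  S-isods = S-outDominating , λ v v∉S →
    w , ∈-inNbhd⁻ D (∉S⇒∈inNbhd v∉S) , w∈S , Swap.S′-outDominating v∉S

minIndeg≤indeg : ∀ {n} (D : Digraph n) v → minIndeg D ≤ indeg D v
minIndeg≤indeg {n} D v = All.lookup minIndeg≤all (∈-map⁺ (indeg D) (∈-allFin v))
  where
  minIndeg≤all : All.All (minIndeg D ≤_) (map (indeg D) (allFin n))
  minIndeg≤all = foldr-forcesᵇ
    (λ x y m≤x⊓y → ≤-trans m≤x⊓y (m⊓n≤m x y) , ≤-trans m≤x⊓y (m⊓n≤n x y))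
    n _ ≤-refl

minimumInDegreeVertex : ∀ {n} (D : Digraph (suc n)) →
                        Σ (Fin (suc n)) (λ w → ∀ x → indeg D w ≤ indeg D x)
minimumInDegreeVertex D = argmin (indeg D) zero (allFin _) , λ x →
  f[argmin]≤v⁺ {f = indeg D} zero (allFin _) (inj₂ (Any.map (λ { refl → ≤-refl }) (∈-allFin x)))

isods-≤n∸minIndeg : ∀ n (D : Digraph n) →
                    Σ (Subset n) (λ S → ISODS D S × ∣ S ∣ ≤ n ∸ minIndeg D)
isods-≤n∸minIndeg 0       D = [] , ((λ ()) , (λ ())) , z≤n
isods-≤n∸minIndeg (suc n) D with minimumInDegreeVertex D
... | w , w-minimal = S , S-isods , ∣S∣≤n∸minIndeg
  where
  open MinimumInDegree D w w-minimal
  open ≤-Reasoning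
  ∣S∣≤n∸minIndeg : ∣ S ∣ ≤ suc n ∸ minIndeg D
  ∣S∣≤n∸minIndeg = begin
    ∣ S ∣               ≡⟨ ∣S∣≡n∸indeg ⟩
    suc n ∸ indeg D w   ≤⟨ ∸-monoʳ-≤ (suc n) (minIndeg≤indeg D w) ⟩
    suc n ∸ minIndeg D  ∎

x∈p⇒1≤∣p∣ : ∀ {n} {p : Subset n} {x} → x ∈ p → 1 ≤ ∣ p ∣
x∈p⇒1≤∣p∣ x∈p = ≤-trans (s≤s z≤n) (x∈p⇒∣p-x∣<∣p∣ x∈p)

outDominating⇒1≤∣S∣ : ∀ {n} (D : Digraph (suc n)) {S} → OutDominating D S → 1 ≤ ∣ S ∣
outDominating⇒1≤∣S∣ D {S} dominating with zero ∈? S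
... | yes 0∈S = x∈p⇒1≤∣p∣ 0∈S
... | no 0∉S with dominating zero 0∉S
...   | _ , u∈S , _ = x∈p⇒1≤∣p∣ u∈S

isoDomNumber≡1 : ∀ {n} (D : Digraph (suc n)) → minIndeg D ≡ n → IsoDomNumber D 1
isoDomNumber≡1 {n} D δ≡n = minimal (isods-≤n∸minIndeg (suc n) D)
  where
  1≤∣S∣ : ∀ S → ISODS D S → 1 ≤ ∣ S ∣
  1≤∣S∣ S (dominating , _) = outDominating⇒1≤∣S∣ D dominating

  n∸δ≡1 : suc n ∸ minIndeg D ≡ 1
  n∸δ≡1 = trans (cong (suc n ∸_) δ≡n) (m+n∸n≡m 1 n)

  minimal : Σ (Subset (suc n)) (λ S → ISODS D S × ∣ S ∣ ≤ suc n ∸ minIndeg D) →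
            IsoDomNumber D 1
  minimal (S , S-isods , ∣S∣≤n∸δ) =
    (S , S-isods , ≤-antisym (≤-trans ∣S∣≤n∸δ (≤-reflexive n∸δ≡1)) (1≤∣S∣ S S-isods)) , 1≤∣S∣

twoCycle : Digraph 2
twoCycle = record { adj = arc ; loopless = λ { zero → refl ; (suc zero) → refl } }
  where
  arc : Fin 2 → Fin 2 → Bool
  arc zero       zero       = false
  arc zero       (suc zero) = true
  arc (suc zero) zero       = true
  arc (suc zero) (suc zero) = false

theorem5p3 : (∀ (n : ℕ) (D : Digraph n) →
                Σ (Subset n) (λ S → ISODS D S × ∣ S ∣ ≤ n ∸ minIndeg D))
             × Σ ℕ (λ n → Σ (Digraph n) (λ D →
                1 ≤ minIndeg D × IsoDomNumber D (n ∸ minIndeg D)))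
theorem5p3 = isods-≤n∸minIndeg , 2 , twoCycle , s≤s z≤n , isoDomNumber≡1 twoCycle refl
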